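{- Let $\mathcal{G}$ be a hereditary family of graphs (closed under taking induced subgraphs) such that $\chi(G) = \chi_L(G)$ for every $G \in \mathcal{G}$. Then for every $G \in \mathcal{G}$ on $n$ vertices and every integer $t$ with $0 < t \leq \chi_L(G)$, $\lambda_t(G) \geq \frac{tn}{\chi_L(G)}$.
   Context: $\chi(G)$ is the chromatic number. For a graph $G$ and a positive integer $k$, a $k$-assignment is a function assigning to each vertex $v$ a list $l(v)$ of exactly $k$ colours. $G$ is $\mathcal{L}$-list colourable if there is a proper vertex colouring in which each vertex $v$ receives a colour from $l(v)$; $G$ is $k$-choosable if it is $\mathcal{L}$-list colourable for every $k$-assignment $\mathcal{L}$. The list chromatic number $\chi_L(G)$ is the least $k$ such that $G$ is $k$-choosable. For a $t$-assignment $\mathcal{L}_t$, $\lambda_{\mathcal{L}_t}(G)$ is the maximum number of vertices of an induced subgraph of $G$ that is $\mathcal{L}_t$-list colourable, and $\lambda_t(G) = \min\{\lambda_{\mathcal{L}_t}(G) : \mathcal{L}_t \text{ a } t\text{ -assignment for } G\}$. -}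

module Defs where

open import Data.Nat using (ℕ; _<_; _≤_)
open import Data.Fin using (Fin)
open import Data.Fin.Subset using (Subset; _∈_; ∣_∣)
open import Data.Bool using (Bool; true; false)
open import Data.List using (List; length)
import Data.List.Membership.Propositional as LM
open import Data.List.Relation.Unary.Unique.Propositional using (Unique)
open import Data.Product using (Σ; _×_)
open import Relation.Binary.PropositionalEquality using (_≡_; _≢_)
open import Relation.Nullary using (¬_)
open import Function.Definitions using (Injective)

record Graph (n : ℕ) : Set where
  field
    adj    : Fin n → Fin n → Bool
    sym    : ∀ u v → adj u v ≡ adj v u
    irrefl : ∀ v → adj v v ≡ false
open Graph public

Adj : ∀ {n} → Graph n → Fin n → Fin n → Set
Adj G u v = adj G u v ≡ true

-- Induced subgraph along an injective vertex map f : Fin m → Fin n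
-- (this also covers isomorphic copies of induced subgraphs).
induced : ∀ {m n} → Graph n → (f : Fin m → Fin n) → Graph m
induced G f = record
  { adj = λ u v → adj G (f u) (f v)
  ; sym = λ u v → sym G (f u) (f v)
  ; irrefl = λ v → irrefl G (f v) }

Family : Set₁
Family = ∀ {n} → Graph n → Set

Hereditary : Family → Set
Hereditary 𝒢 = ∀ {m n} (G : Graph n) (f : Fin m → Fin n) →
  Injective _≡_ _≡_ f → 𝒢 G → 𝒢 (induced G f)

Colourable : ∀ {n} → Graph n → ℕ → Set
Colourable {n} G k = Σ (Fin n → Fin k) λ c → ∀ u v → Adj G u v → c u ≢ c v

IsChromaticNumber : ∀ {n} → Graph n → ℕ → Set
IsChromaticNumber G k = Colourable G k × (∀ j → j < k → ¬ Colourable G j)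

Assignment : ℕ → Set
Assignment n = Fin n → List ℕ

IsAssignment : ∀ {n} → ℕ → Assignment n → Set
IsAssignment k L = ∀ v → length (L v) ≡ k × Unique (L v)

ListColourable : ∀ {n} → Graph n → Assignment n → Set
ListColourable {n} G L = Σ (Fin n → ℕ) λ c →
  (∀ v → c v LM.∈ L v) × (∀ u v → Adj G u v → c u ≢ c v)

Choosable : ∀ {n} → Graph n → ℕ → Set
Choosable {n} G k = (L : Assignment n) → IsAssignment k L → ListColourable G L

IsListChromaticNumber : ∀ {n} → Graph n → ℕ → Set
IsListChromaticNumber G k = Choosable G k × (∀ j → j < k → ¬ Choosable G j)

-- The induced subgraph on vertex set S is L-list colourable
-- (colouring only constrained on S).
InducedListColourable : ∀ {n} → Graph n → Assignment n → Subset n → Set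
InducedListColourable {n} G L S = Σ (Fin n → ℕ) λ c →
  (∀ v → v ∈ S → c v LM.∈ L v) ×
  (∀ u v → u ∈ S → v ∈ S → Adj G u v → c u ≢ c v)

IsLambdaL : ∀ {n} → Graph n → Assignment n → ℕ → Set
IsLambdaL {n} G L m =
  Σ (Subset n) (λ S → InducedListColourable G L S × ∣ S ∣ ≡ m) ×
  (∀ S → InducedListColourable G L S → ∣ S ∣ ≤ m)

IsLambda : ∀ {n} → ℕ → Graph n → ℕ → Set
IsLambda {n} t G m =
  Σ (Assignment n) (λ L → IsAssignment t L × IsLambdaL G L m) ×
  (∀ L → IsAssignment t L → ∀ m' → IsLambdaL G L m' → m ≤ m')

-- Fix a proper colouring of G with k = χ(G) = χ_L(G) colours, read as residues mod k. For each
-- shift s, the vertices whose colour plus s lies below t (mod k) induce a t-colourable subgraph H;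
-- H is in the family, so χ_L(H) = χ(H) ≤ t and H is L-colourable for every t-assignment L, whence
-- it has at most λ_L(G) vertices. Every vertex lies in exactly t of these k cyclic windows, so
-- summing over the k shifts gives t n ≤ k λ_L(G).
-- Chromatic numbers exist only classically; the double-negated least number principle suffices
-- because the conclusion is a decidable inequality.
module Submission where

open import Defs
open import Data.Nat using (ℕ; _*_; _≤_; _<_)
open import Relation.Binary.PropositionalEquality using (_≡_)

open import Algebra.Properties.CommutativeMonoid.Sum as Sum using ()
open import Data.Bool using (Bool; true; false; T)
open import Data.Bool.Properties using (T-≡)
open import Data.Fin using (Fin; zero; suc; toℕ; fromℕ; fromℕ<)
open import Data.Fin.Properties using (_≟_; any?; suc-injective; toℕ-injective; toℕ<n; toℕ-fromℕ; toℕ-fromℕ<; toℕ-inject₁)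
open import Data.Fin.Subset using (Subset; _∈_; ∣_∣; inside; outside)
open import Data.List using (length; take; upTo)
open import Data.List.Membership.Propositional using () renaming (_∈_ to _∈ₗ_)
open import Data.List.Membership.Propositional.Properties using (∈-++⁺ˡ)
open import Data.List.Properties using (length-take; length-upTo; take++drop≡id)
open import Data.List.Relation.Unary.Unique.Propositional using (Unique)
open import Data.List.Relation.Unary.Unique.Propositional.Properties using (take⁺; upTo⁺)
open import Data.Nat using (zero; suc; _+_; _⊓_; _%_; _<ᵇ_; _≤?_; NonZero; z≤n)
open import Data.Nat.DivMod using (m<n⇒m%n≡m; [m+n]%n≡m%n; [m+kn]%n≡m%n; %-distribˡ-+)
open import Data.Nat.Induction using (<-wellFounded)
open import Data.Nat.Properties using (+-0-commutativeMonoid; +-mono-≤; +-cancelˡ-≡; +-suc; +-comm; +-assoc; +-identityʳ; *-suc; *-comm; ⊓-zeroʳ; m≥n⇒m⊓n≡n; m≤n⇒m⊓n≡m; ≤-refl; ≤-trans; <⇒≤; <ᵇ⇒<; module ≤-Reasoning)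
open import Data.Product using (∃; _×_; _,_; proj₁; proj₂)
open import Data.Vec using ([]; _∷_; tabulate; here; there)
open import Data.Vec.Functional using (init; last)
open import Data.Vec.Properties using ([]=⇒lookup; lookup∘tabulate)
open import Effect.Monad using (RawMonad)
open import Function using (_∘_; id; Equivalence)
open import Function.Definitions using (Injective)
open import Induction.WellFounded using (Acc; acc)
open import Level using (0ℓ)
import Relation.Binary.PropositionalEquality as ≡
open import Relation.Binary.PropositionalEquality using (_≢_; refl; trans; cong; cong₂; subst; module ≡-Reasoning)
open import Relation.Nullary using (¬_; yes; no)
open import Relation.Nullary.Decidable using (decidable-stable; ¬¬-excluded-middle)
open import Relation.Nullary.Negation using (¬¬-Monad; ¬¬-map; contradiction)

open Sum +-0-commutativeMonoid using (sum; sum-syntax; ∑-comm; sum-cong-≗; sum-init-last)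
open RawMonad (¬¬-Monad {0ℓ})

iverson : Bool → ℕ
iverson false = 0
iverson true  = 1

∑-const : ∀ n x → ∑[ i < n ] x ≡ n * x
∑-const zero    x = refl
∑-const (suc n) x = cong (x +_) (∑-const n x)

∑-≤-const : ∀ {n b} (f : Fin n → ℕ) → (∀ i → f i ≤ b) → sum f ≤ n * b
∑-≤-const {zero}  f f≤b = z≤n
∑-≤-const {suc n} f f≤b = +-mono-≤ (f≤b zero) (∑-≤-const (f ∘ suc) (f≤b ∘ suc))

∑-shift : ∀ K (h : ℕ → ℕ) → (∀ x → h (x + K) ≡ h x) → ∀ a →
  ∑[ s < K ] h (suc a + toℕ s) ≡ ∑[ s < K ] h (a + toℕ s)
∑-shift K h periodic a = +-cancelˡ-≡ (g zero) _ _ (begin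
  g zero + ∑[ s < K ] h (suc a + toℕ s)
    ≡⟨ cong (g zero +_) (sum-cong-≗ {K} λ s → cong h (+-suc a (toℕ s))) ⟨
  sum g
    ≡⟨ sum-init-last g ⟩
  sum (init g) + last g
    ≡⟨ cong₂ _+_ (sum-cong-≗ {K} λ s → cong (λ x → h (a + x)) (toℕ-inject₁ s)) wraps ⟩
  ∑[ s < K ] h (a + toℕ s) + g zero
    ≡⟨ +-comm _ (g zero) ⟩
  g zero + ∑[ s < K ] h (a + toℕ s) ∎)
  where
  open ≡-Reasoning
  g : Fin (suc K) → ℕ
  g i = h (a + toℕ i)
  wraps : last g ≡ g zero
  wraps = begin
    h (a + toℕ (fromℕ K)) ≡⟨ cong (λ x → h (a + x)) (toℕ-fromℕ K) ⟩
    h (a + K)             ≡⟨ periodic a ⟩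
    h a                   ≡⟨ cong h (+-identityʳ a) ⟨
    h (a + 0)             ∎

∑-periodic : ∀ K (h : ℕ → ℕ) → (∀ x → h (x + K) ≡ h x) → ∀ a →
  ∑[ s < K ] h (a + toℕ s) ≡ ∑[ s < K ] h (toℕ s)
∑-periodic K h periodic zero    = refl
∑-periodic K h periodic (suc a) = trans (∑-shift K h periodic a) (∑-periodic K h periodic a)

∑-<ᵇ : ∀ K t → ∑[ s < K ] iverson (toℕ s <ᵇ t) ≡ K ⊓ t
∑-<ᵇ zero    t       = refl
∑-<ᵇ (suc K) zero    = trans (∑-<ᵇ K zero) (⊓-zeroʳ K)
∑-<ᵇ (suc K) (suc t) = cong suc (∑-<ᵇ K t)

∑-window : ∀ K .{{_ : NonZero K}} {t} → t ≤ K → ∀ i →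
  ∑[ s < K ] iverson ((i + toℕ s) % K <ᵇ t) ≡ t
∑-window K {t} t≤K i = begin
  ∑[ s < K ] inWindow (i + toℕ s) ≡⟨ ∑-periodic K inWindow (λ x → cong (λ y → iverson (y <ᵇ t)) ([m+n]%n≡m%n x K)) i ⟩
  ∑[ s < K ] inWindow (toℕ s)     ≡⟨ sum-cong-≗ (λ s → cong (λ y → iverson (y <ᵇ t)) (m<n⇒m%n≡m (toℕ<n s))) ⟩
  ∑[ s < K ] iverson (toℕ s <ᵇ t) ≡⟨ ∑-<ᵇ K t ⟩
  K ⊓ t                           ≡⟨ m≥n⇒m⊓n≡n t≤K ⟩
  t                               ∎
  where
  open ≡-Reasoning
  inWindow : ℕ → ℕ
  inWindow x = iverson (x % K <ᵇ t)

+-%-cancelʳ : ∀ k s {x y} → x < suc k → y < suc k →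
  (x + s) % suc k ≡ (y + s) % suc k → x ≡ y
+-%-cancelʳ k s {x} {y} x<K y<K eq = begin
  x                                           ≡⟨ recover x<K ⟩
  ((x + s) % suc k + (k * s) % suc k) % suc k ≡⟨ cong (λ r → (r + (k * s) % suc k) % suc k) eq ⟩
  ((y + s) % suc k + (k * s) % suc k) % suc k ≡⟨ recover y<K ⟨
  y                                           ∎
  where
  open ≡-Reasoning
  -- adding k * s after s adds a multiple of suc k, so the residue of z + s determines z
  recover : ∀ {z} → z < suc k → z ≡ ((z + s) % suc k + (k * s) % suc k) % suc k
  recover {z} z<K = begin
    z                                           ≡⟨ m<n⇒m%n≡m z<K ⟨
    z % suc k                                   ≡⟨ [m+kn]%n≡m%n z s (suc k) ⟨
    (z + s * suc k) % suc k                     ≡⟨ cong (λ r → (z + r) % suc k) (trans (*-suc s k) (cong (s +_) (*-comm s k))) ⟩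
    (z + (s + k * s)) % suc k                   ≡⟨ cong (_% suc k) (+-assoc z s (k * s)) ⟨
    (z + s + k * s) % suc k                     ≡⟨ %-distribˡ-+ (z + s) (k * s) (suc k) ⟩
    ((z + s) % suc k + (k * s) % suc k) % suc k ∎

least-¬¬ : (Q : ℕ → Set) → ∀ N → Q N →
  ¬ ¬ (∃ λ j → j ≤ N × Q j × (∀ i → i < j → ¬ Q i))
least-¬¬ Q N = go N (<-wellFounded N)
  where
  go : ∀ N → Acc _<_ N → Q N → ¬ ¬ (∃ λ j → j ≤ N × Q j × (∀ i → i < j → ¬ Q i))
  go N (acc smaller) qN = do
    yes (i , i<N , qi) ← ¬¬-excluded-middle {A = ∃ λ i → i < N × Q i}
      where no none → pure (N , ≤-refl , qN , λ i i<N qi → none (i , i<N , qi))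
    (j , j≤i , least) ← go i (smaller i<N) qi
    pure (j , ≤-trans j≤i (<⇒≤ i<N) , least)

ChromaticChoosable : ∀ {n} → Graph n → Set
ChromaticChoosable G = ∀ a b → IsChromaticNumber G a → IsListChromaticNumber G b → a ≡ b

Adj⇒≢ : ∀ {n} (G : Graph n) {u v} → Adj G u v → u ≢ v
Adj⇒≢ G {u} uv refl with trans (≡.sym uv) (irrefl G u)
... | ()

colourable-order : ∀ {n} (G : Graph n) → Colourable G n
colourable-order G = id , λ u v → Adj⇒≢ G

∈-take : ∀ {x : ℕ} j xs → x ∈ₗ take j xs → x ∈ₗ xs
∈-take j xs x∈ = subst (_ ∈ₗ_) (take++drop≡id j xs) (∈-++⁺ˡ x∈)

choosable-mono : ∀ {n} (G : Graph n) {j k} → j ≤ k → Choosable G j → Choosable G k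
choosable-mono G {j} j≤k choose L isL =
  let (c , c∈ , proper) = choose (take j ∘ L) isL′
  in c , (λ v → ∈-take j (L v) (c∈ v)) , proper
  where
  isL′ : IsAssignment j (take j ∘ L)
  isL′ v = trans (length-take j (L v)) (trans (cong (j ⊓_) (proj₁ (isL v))) (m≤n⇒m⊓n≡m j≤k))
         , take⁺ j (proj₂ (isL v))

χ≡χL⇒¬¬colourable : ∀ {n} (G : Graph n) {k} → ChromaticChoosable G →
  IsListChromaticNumber G k → ¬ ¬ Colourable G k
χ≡χL⇒¬¬colourable G {k} χ≡χL isχL = do
  (a , _ , isχ) ← least-¬¬ (Colourable G) _ (colourable-order G)
  pure (subst (Colourable G) (χ≡χL a k isχ isχL) (proj₁ isχ))

colourable⇒¬¬choosable : ∀ {n} (G : Graph n) {k t} → ChromaticChoosable G →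
  Choosable G k → Colourable G t → ¬ ¬ Choosable G t
colourable⇒¬¬choosable G χ≡χL choosable colourable = do
  (a , a≤t , isχ) ← least-¬¬ (Colourable G) _ colourable
  (b , _ , isχL) ← least-¬¬ (Choosable G) _ choosable
  pure (choosable-mono G (subst (_≤ _) (χ≡χL a b isχ isχL) a≤t) (proj₁ isχL))

extend : ∀ {m n} {A : Set} → (Fin m → Fin n) → (Fin m → A) → A → Fin n → A
extend f h d v with any? (λ w → f w ≟ v)
... | yes (w , _) = h w
... | no _        = d

extend-preserves : ∀ {m n} {A : Set} (P : A → Set) (f : Fin m → Fin n) {h d} →
  (∀ w → P (h w)) → P d → ∀ v → P (extend f h d v)
extend-preserves P f Ph Pd v with any? (λ w → f w ≟ v)
... | yes (w , _) = Ph w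
... | no _        = Pd

extend-image : ∀ {m n} {A : Set} {f : Fin m → Fin n} → Injective _≡_ _≡_ f →
  ∀ (h : Fin m → A) d w → extend f h d (f w) ≡ h w
extend-image {f = f} f-injective h d w with any? (λ w′ → f w′ ≟ f w)
... | yes (w′ , fw′≡fw) = cong h (f-injective fw′≡fw)
... | no ∄              = contradiction (w , refl) ∄

choosable-induced : ∀ {m n k} (G : Graph n) {f : Fin m → Fin n} → Injective _≡_ _≡_ f →
  Choosable G k → Choosable (induced G f) k
choosable-induced {k = k} G {f} f-injective choose L isL =
  let (c , c∈ , proper) = choose (extend f L (upTo k)) isL′
  in c ∘ f , (λ w → subst (c (f w) ∈ₗ_) (extend-image f-injective L (upTo k) w) (c∈ (f w)))
           , (λ u v → proper (f u) (f v))
  where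
  isL′ : IsAssignment k (extend f L (upTo k))
  isL′ = extend-preserves (λ xs → length xs ≡ k × Unique xs) f isL (length-upTo k , upTo⁺ k)

inducedListColourable-image : ∀ {m n} (G : Graph n) {f : Fin m → Fin n} → Injective _≡_ _≡_ f →
  (L : Assignment n) (S : Subset n) → (∀ {v} → v ∈ S → ∃ λ w → f w ≡ v) →
  ListColourable (induced G f) (L ∘ f) → InducedListColourable G L S
inducedListColourable-image G {f} f-injective L S cover (d , d∈ , proper) = c , c∈ , c-proper
  where
  c : Fin _ → ℕ
  c = extend f d 0
  c∘f : ∀ w → c (f w) ≡ d w
  c∘f = extend-image f-injective d 0
  c∈ : ∀ v → v ∈ S → c v ∈ₗ L v
  c∈ v v∈S with cover v∈S
  ... | w , refl = subst (_∈ₗ L (f w)) (≡.sym (c∘f w)) (d∈ w)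
  c-proper : ∀ u v → u ∈ S → v ∈ S → Adj G u v → c u ≢ c v
  c-proper u v u∈S v∈S uv with cover u∈S | cover v∈S
  ... | w₁ , refl | w₂ , refl rewrite c∘f w₁ | c∘f w₂ = proper w₁ w₂ uv

record Enumeration {n} (S : Subset n) : Set where
  field
    size             : ℕ
    elem             : Fin size → Fin n
    elem-injective   : Injective _≡_ _≡_ elem
    elem∈            : ∀ w → elem w ∈ S
    elem-surjective  : ∀ {v} → v ∈ S → ∃ λ w → elem w ≡ v

enumerate : ∀ {n} (S : Subset n) → Enumeration S
enumerate [] = record
  { size = 0 ; elem = λ () ; elem-injective = λ { {()} } ; elem∈ = λ () ; elem-surjective = λ () }
enumerate (outside ∷ S) = record
  { size            = size
  ; elem            = suc ∘ elem
  ; elem-injective  = elem-injective ∘ suc-injective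
  ; elem∈           = there ∘ elem∈
  ; elem-surjective = λ { (there v∈S) → let (w , eq) = elem-surjective v∈S in w , cong suc eq }
  }
  where open Enumeration (enumerate S)
enumerate (inside ∷ S) = record
  { size = suc size ; elem = elem′ ; elem-injective = injective ; elem∈ = elem′∈ ; elem-surjective = surjective }
  where
  open Enumeration (enumerate S)
  elem′ : Fin (suc size) → Fin _
  elem′ zero    = zero
  elem′ (suc w) = suc (elem w)
  injective : Injective _≡_ _≡_ elem′
  injective {zero}  {zero}  _  = refl
  injective {suc w} {suc _} eq = cong suc (elem-injective (suc-injective eq))
  injective {zero}  {suc _} ()
  injective {suc _} {zero}  ()
  elem′∈ : ∀ w → elem′ w ∈ inside ∷ S
  elem′∈ zero    = here
  elem′∈ (suc w) = there (elem∈ w)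
  surjective : ∀ {v} → v ∈ inside ∷ S → ∃ λ w → elem′ w ≡ v
  surjective here        = zero , refl
  surjective (there v∈S) = let (w , eq) = elem-surjective v∈S in suc w , cong suc eq

∣tabulate∣ : ∀ {n} (P : Fin n → Bool) → ∣ tabulate P ∣ ≡ ∑[ v < n ] iverson (P v)
∣tabulate∣ {zero}  P = refl
∣tabulate∣ {suc n} P with P zero
... | true  = cong suc (∣tabulate∣ (P ∘ suc))
... | false = ∣tabulate∣ (P ∘ suc)

∈-tabulate : ∀ {n} {P : Fin n → Bool} {v} → v ∈ tabulate P → T (P v)
∈-tabulate {P = P} {v} v∈ = Equivalence.from T-≡ (trans (≡.sym (lookup∘tabulate P v)) ([]=⇒lookup v∈))

InducedColourable⇒¬¬Choosable : ∀ {n} → Graph n → ℕ → Set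
InducedColourable⇒¬¬Choosable {n} G t = ∀ {m} (f : Fin m → Fin n) → Injective _≡_ _≡_ f →
  Colourable (induced G f) t → ¬ ¬ Choosable (induced G f) t

module CyclicWindows {n k} (G : Graph n) (colouring : Colourable G (suc k)) (t : ℕ) where

  c : Fin n → Fin (suc k)
  c = proj₁ colouring

  window : ℕ → Subset n
  window s = tabulate λ v → (toℕ (c v) + s) % suc k <ᵇ t

  window-colourable : ∀ s {m} (f : Fin m → Fin n) → (∀ w → f w ∈ window s) →
    Colourable (induced G f) t
  window-colourable s f f∈ = colour , proper
    where
    shifted : Fin _ → ℕ
    shifted w = (toℕ (c (f w)) + s) % suc k
    colour : Fin _ → Fin t
    colour w = fromℕ< (<ᵇ⇒< (shifted w) t (∈-tabulate (f∈ w)))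
    proper : ∀ u v → Adj G (f u) (f v) → colour u ≢ colour v
    proper u v uv eq = proj₂ colouring (f u) (f v) uv (toℕ-injective
      (+-%-cancelʳ k s (toℕ<n (c (f u))) (toℕ<n (c (f v)))
        (trans (≡.sym (toℕ-fromℕ< _)) (trans (cong toℕ eq) (toℕ-fromℕ< _)))))

  ∑-∣window∣ : t ≤ suc k → ∑[ s < suc k ] ∣ window (toℕ s) ∣ ≡ n * t
  ∑-∣window∣ t≤K = begin
    ∑[ s < suc k ] ∣ window (toℕ s) ∣
      ≡⟨ sum-cong-≗ {suc k} (λ s → ∣tabulate∣ (λ v → (toℕ (c v) + toℕ s) % suc k <ᵇ t)) ⟩
    ∑[ s < suc k ] ∑[ v < n ] iverson ((toℕ (c v) + toℕ s) % suc k <ᵇ t)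
      ≡⟨ ∑-comm {suc k} {n} (λ s v → iverson ((toℕ (c v) + toℕ s) % suc k <ᵇ t)) ⟩
    ∑[ v < n ] ∑[ s < suc k ] iverson ((toℕ (c v) + toℕ s) % suc k <ᵇ t)
      ≡⟨ sum-cong-≗ {n} (λ v → ∑-window (suc k) t≤K (toℕ (c v))) ⟩
    ∑[ v < n ] t
      ≡⟨ ∑-const n t ⟩
    n * t ∎
    where open ≡-Reasoning

  window-bound : ∀ {L m} → InducedColourable⇒¬¬Choosable G t → IsAssignment t L →
    (∀ S → InducedListColourable G L S → ∣ S ∣ ≤ m) → ∀ s → ∣ window s ∣ ≤ m
  window-bound {L} {m} choosable isL maximal s = decidable-stable (_ ≤? m) (¬¬-map
    (λ choose → maximal (window s) (inducedListColourable-image G elem-injective L (window s)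
      elem-surjective (choose (L ∘ elem) (isL ∘ elem))))
    (choosable elem elem-injective (window-colourable s elem elem∈)))
    where open Enumeration (enumerate (window s))

listColouring-bound : ∀ {n k t m} (G : Graph n) (L : Assignment n) →
  Colourable G (suc k) → t ≤ suc k → InducedColourable⇒¬¬Choosable G t → IsAssignment t L →
  (∀ S → InducedListColourable G L S → ∣ S ∣ ≤ m) → t * n ≤ m * suc k
listColouring-bound {n} {k} {t} {m} G L colouring t≤K choosable isL maximal = begin
  t * n                              ≡⟨ *-comm t n ⟩
  n * t                              ≡⟨ ∑-∣window∣ t≤K ⟨
  ∑[ s < suc k ] ∣ window (toℕ s) ∣  ≤⟨ ∑-≤-const {suc k} _ (window-bound choosable isL maximal ∘ toℕ) ⟩
  suc k * m                          ≡⟨ *-comm (suc k) m ⟩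
  m * suc k                          ∎
  where
  open CyclicWindows G colouring t
  open ≤-Reasoning

mainTheorem6 : (𝒢 : Family) → Hereditary 𝒢 →
    (∀ {n} (G : Graph n) → 𝒢 G → ∀ a b →
      IsChromaticNumber G a → IsListChromaticNumber G b → a ≡ b) →
    ∀ {n} (G : Graph n) → 𝒢 G →
    ∀ (k t m : ℕ) → IsListChromaticNumber G k → 0 < t → t ≤ k →
    IsLambda t G m → t * n ≤ m * k
mainTheorem6 _ _ _ _ _ zero _ _ _ () z≤n _
mainTheorem6 _ hereditary χ≡χL {n} G G∈𝒢 (suc k) t m isχL _ t≤k ((L , isL , _ , maximal) , _) =
  decidable-stable (t * n ≤? m * suc k) (do
    colouring ← χ≡χL⇒¬¬colourable G (χ≡χL G G∈𝒢) isχL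
    pure (listColouring-bound G L colouring t≤k inducedChoosable isL maximal))
  where
  inducedChoosable : InducedColourable⇒¬¬Choosable G t
  inducedChoosable f f-injective = colourable⇒¬¬choosable (induced G f)
    (χ≡χL _ (hereditary G f f-injective G∈𝒢)) (choosable-induced G f-injective (proj₁ isχL))
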